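{- Let $f,g,h,k$ be complex numbers with $f\neq 0$ and $g\neq 0$, and let $(R_n)_{n\in\mathbb{Z}}$ be the unique two-sided sequence with $R_0=h$, $R_1=k$ and $R_{n+1}=fR_n+gR_{n-1}$ for all $n\in\mathbb{Z}$. Define $$A=\begin{bmatrix} 2gh+f^{2}h-fk & 2kg-fhg\\ 2k-fh & 2gh+fk\end{bmatrix},\quad B=\begin{bmatrix}0 & g\\ 1 & f\end{bmatrix},\quad C=\begin{bmatrix}2g & fg\\ f & f^{2}+2g\end{bmatrix},\quad D=\begin{bmatrix}-f & 2g\\ 2 & f\end{bmatrix}.$$ Then for every integer $n$, $$AB^{n}=C\,R_{n}+D\,g\,R_{n-1}.$$
   Context: The paper works with complex functions $f(z),g(z),h(z),k(z)$; here these are evaluated at a fixed point $z$, so they are complex numbers. The paper assumes throughout that $f\neq0$ and $g\neq0$. Since $g\neq 0$ and $\det B=-g$, the recurrence can be run backwards via $R_{n-1}=(R_{n+1}-fR_n)/g$, so $R_n$ is defined for all $n\in\mathbb{Z}$, and $B^n$ is defined for negative $n$. -}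

module Defs where

open import Level using (Level; _⊔_)
open import Algebra.Bundles using (CommutativeRing)
open import Data.Nat using (ℕ; zero; suc)
open import Data.Integer using (ℤ; +_; -[1+_])
open import Data.Product using (_×_)

-- 2×2 matrices over a commutative ring (the paper works over ℂ; the
-- identity is stated here over an arbitrary commutative ring, ℂ being one).
module Mat2 {c ℓ : Level} (Rg : CommutativeRing c ℓ) where
  open CommutativeRing Rg

  record M2 : Set c where
    constructor mat
    field
      m11 m12 m21 m22 : Carrier
  open M2 public

  _≈M_ : M2 → M2 → Set ℓ
  X ≈M Y = (m11 X ≈ m11 Y) × (m12 X ≈ m12 Y) × (m21 X ≈ m21 Y) × (m22 X ≈ m22 Y)

  _·M_ : M2 → M2 → M2
  X ·M Y = mat (m11 X * m11 Y + m12 X * m21 Y) (m11 X * m12 Y + m12 X * m22 Y)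
               (m21 X * m11 Y + m22 X * m21 Y) (m21 X * m12 Y + m22 X * m22 Y)

  _+M_ : M2 → M2 → M2
  X +M Y = mat (m11 X + m11 Y) (m12 X + m12 Y) (m21 X + m21 Y) (m22 X + m22 Y)

  _∙s_ : M2 → Carrier → M2
  X ∙s s = mat (m11 X * s) (m12 X * s) (m21 X * s) (m22 X * s)

  I2 : M2
  I2 = mat 1# 0# 0# 1#

  _^ℕ_ : M2 → ℕ → M2
  X ^ℕ zero = I2
  X ^ℕ suc n = X ·M (X ^ℕ n)

  Bm : Carrier → Carrier → M2
  Bm f g = mat 0# g 1# f

  -- B⁻¹ = [[-f/g, 1], [1/g, 0]], where ginv is the inverse of g
  -- (det B = -g ≠ 0).
  Binv : Carrier → Carrier → M2
  Binv f ginv = mat (- (f * ginv)) 1# ginv 0#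

  Bpow : (f g ginv : Carrier) → ℤ → M2
  Bpow f g ginv (+ n)      = Bm f g ^ℕ n
  Bpow f g ginv -[1+ n ]   = Binv f ginv ^ℕ suc n

  Am : (f g h k : Carrier) → M2
  Am f g h k = mat (2g h + f * f * h - f * k) (2# * k * g - f * h * g)
                   (2# * k - f * h) (2g h + f * k)
    where
      2# = 1# + 1#
      2g : Carrier → Carrier
      2g x = 2# * g * x

  Cm : (f g : Carrier) → M2
  Cm f g = mat (2# * g) (f * g) f (f * f + 2# * g)
    where 2# = 1# + 1#

  Dm : (f g : Carrier) → M2
  Dm f g = mat (- f) (2# * g) 2# f
    where 2# = 1# + 1#

{-# OPTIONS --safe #-}
module Submission where

-- The matrices Q n = C Rₙ + D g Rₙ₋₁ satisfy Q (n + 1) = Q n B: this is the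
-- identity (C x + D y) B = C (f x + y) + D (g x) combined with the recurrence.
-- Since A = Q 0, induction gives A Bⁿ = Q n for n ≥ 0, and B B⁻¹ = I turns the
-- same step around, Q (n - 1) = Q n B⁻¹, for n < 0.

open import Defs
open import Level using (Level)
open import Algebra.Bundles using (CommutativeRing)
open import Relation.Nullary using (¬_)
open import Data.Integer using (ℤ; +_; -[1+_]) renaming (_+_ to _+ℤ_; _-_ to _-ℤ_; -_ to -ℤ_)
import Data.Integer.Properties as ℤ
open import Algebra.Properties.AbelianGroup ℤ.+-0-abelianGroup using (//-rightDividesˡ; //-rightDividesʳ)
open import Data.Nat using (zero; suc)
open import Data.Product using (_,_)
open import Relation.Binary.Bundles using (Setoid)
open import Relation.Binary.Structures using (IsEquivalence)
import Relation.Binary.PropositionalEquality as ≡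
open ≡ using (_≡_)
import Relation.Binary.Reasoning.Setoid as SetoidReasoning

[i+1]-1≡i : ∀ i → (i +ℤ + 1) -ℤ + 1 ≡ i
[i+1]-1≡i = //-rightDividesʳ (+ 1)

[i-1]+1≡i : ∀ i → (i -ℤ + 1) +ℤ + 1 ≡ i
[i-1]+1≡i = //-rightDividesˡ (+ 1)

[i+1]+n≡i+[1+n] : ∀ i n → (i +ℤ + 1) +ℤ + n ≡ i +ℤ + suc n
[i+1]+n≡i+[1+n] i n = ℤ.+-assoc i (+ 1) (+ n)

[i-1]-n≡i-[1+n] : ∀ i n → (i -ℤ + 1) -ℤ + n ≡ i -ℤ + suc n
[i-1]-n≡i-[1+n] i n = ≡.trans (ℤ.+-assoc i (-ℤ + 1) (-ℤ + n))
                              (≡.cong (i +ℤ_) (≡.sym (ℤ.neg-distrib-+ (+ 1) (+ n))))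

module MatrixIdentities {c ℓ : Level} (Rg : CommutativeRing c ℓ) where
  open CommutativeRing Rg
  open Mat2 Rg
  open import Algebra.Properties.Ring ring using (-‿distribˡ-*)
  open import Algebra.Solver.Ring.NaturalCoefficients.Default commutativeSemiring

  ≈M-isEquivalence : IsEquivalence _≈M_
  ≈M-isEquivalence = record
    { refl  = refl , refl , refl , refl
    ; sym   = λ (p , q , r , s) → sym p , sym q , sym r , sym s
    ; trans = λ (p , q , r , s) (p′ , q′ , r′ , s′) →
                trans p p′ , trans q q′ , trans r r′ , trans s s′
    }

  M2-setoid : Setoid c ℓ
  M2-setoid = record { isEquivalence = ≈M-isEquivalence }

  open Setoid M2-setoid public using () renaming (sym to ≈M-sym; trans to ≈M-trans; reflexive to ≈M-reflexive)
  open SetoidReasoning M2-setoid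

  ·M-congʳ : ∀ {X X′ Y} → X ≈M X′ → (X ·M Y) ≈M (X′ ·M Y)
  ·M-congʳ (p , q , r , s) =
    +-cong (*-congʳ p) (*-congʳ q) , +-cong (*-congʳ p) (*-congʳ q) ,
    +-cong (*-congʳ r) (*-congʳ s) , +-cong (*-congʳ r) (*-congʳ s)

  ·M-congˡ : ∀ {X Y Y′} → Y ≈M Y′ → (X ·M Y) ≈M (X ·M Y′)
  ·M-congˡ (p , q , r , s) =
    +-cong (*-congˡ p) (*-congˡ r) , +-cong (*-congˡ q) (*-congˡ s) ,
    +-cong (*-congˡ p) (*-congˡ r) , +-cong (*-congˡ q) (*-congˡ s)

  ·M-assoc : ∀ X Y Z → ((X ·M Y) ·M Z) ≈M (X ·M (Y ·M Z))
  ·M-assoc (mat a b c d) (mat e f g h) (mat p q r s) =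
    entry a b e f g h p r , entry a b e f g h q s , entry c d e f g h p r , entry c d e f g h q s
    where
    entry : ∀ a b e f g h p r → (a * e + b * g) * p + (a * f + b * h) * r ≈ a * (e * p + f * r) + b * (g * p + h * r)
    entry = solve 8 (λ a b e f g h p r →
      (a :* e :+ b :* g) :* p :+ (a :* f :+ b :* h) :* r := a :* (e :* p :+ f :* r) :+ b :* (g :* p :+ h :* r)) refl

  ·M-identityʳ : ∀ X → (X ·M I2) ≈M X
  ·M-identityʳ (mat a b c d) = entry₁ a b , entry₂ a b , entry₁ c d , entry₂ c d
    where
    entry₁ : ∀ a b → a * 1# + b * 0# ≈ a
    entry₁ a b = trans (+-cong (*-identityʳ a) (zeroʳ b)) (+-identityʳ a)
    entry₂ : ∀ a b → a * 0# + b * 1# ≈ b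
    entry₂ a b = trans (+-cong (zeroʳ a) (*-identityʳ b)) (+-identityˡ b)

  module Orbit (B B⁻¹ : M2) (B·B⁻¹≈I : (B ·M B⁻¹) ≈M I2)
               (Q : ℤ → M2) (Q-suc : ∀ n → Q (n +ℤ + 1) ≈M (Q n ·M B)) where

    Q·B^ : ∀ m n → (Q m ·M (B ^ℕ n)) ≈M Q (m +ℤ + n)
    Q·B^ m zero    = ≈M-trans (·M-identityʳ (Q m)) (≈M-reflexive (≡.cong Q (≡.sym (ℤ.+-identityʳ m))))
    Q·B^ m (suc n) = begin
      Q m ·M (B ·M (B ^ℕ n))   ≈⟨ ·M-assoc (Q m) B (B ^ℕ n) ⟨
      (Q m ·M B) ·M (B ^ℕ n)   ≈⟨ ·M-congʳ (Q-suc m) ⟨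
      Q (m +ℤ + 1) ·M (B ^ℕ n) ≈⟨ Q·B^ (m +ℤ + 1) n ⟩
      Q ((m +ℤ + 1) +ℤ + n)    ≡⟨ ≡.cong Q ([i+1]+n≡i+[1+n] m n) ⟩
      Q (m +ℤ + suc n)         ∎

    Q·B⁻¹ : ∀ m → (Q m ·M B⁻¹) ≈M Q (m -ℤ + 1)
    Q·B⁻¹ m = begin
      Q m ·M B⁻¹                     ≡⟨ ≡.cong (λ i → Q i ·M B⁻¹) ([i-1]+1≡i m) ⟨
      Q ((m -ℤ + 1) +ℤ + 1) ·M B⁻¹   ≈⟨ ·M-congʳ (Q-suc (m -ℤ + 1)) ⟩
      (Q (m -ℤ + 1) ·M B) ·M B⁻¹     ≈⟨ ·M-assoc (Q (m -ℤ + 1)) B B⁻¹ ⟩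
      Q (m -ℤ + 1) ·M (B ·M B⁻¹)     ≈⟨ ·M-congˡ B·B⁻¹≈I ⟩
      Q (m -ℤ + 1) ·M I2             ≈⟨ ·M-identityʳ (Q (m -ℤ + 1)) ⟩
      Q (m -ℤ + 1)                   ∎

    Q·B⁻¹^ : ∀ m n → (Q m ·M (B⁻¹ ^ℕ n)) ≈M Q (m -ℤ + n)
    Q·B⁻¹^ m zero    = ≈M-trans (·M-identityʳ (Q m)) (≈M-reflexive (≡.cong Q (≡.sym (ℤ.+-identityʳ m))))
    Q·B⁻¹^ m (suc n) = begin
      Q m ·M (B⁻¹ ·M (B⁻¹ ^ℕ n))   ≈⟨ ·M-assoc (Q m) B⁻¹ (B⁻¹ ^ℕ n) ⟨
      (Q m ·M B⁻¹) ·M (B⁻¹ ^ℕ n)   ≈⟨ ·M-congʳ (Q·B⁻¹ m) ⟩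
      Q (m -ℤ + 1) ·M (B⁻¹ ^ℕ n)   ≈⟨ Q·B⁻¹^ (m -ℤ + 1) n ⟩
      Q ((m -ℤ + 1) -ℤ + n)        ≡⟨ ≡.cong Q ([i-1]-n≡i-[1+n] m n) ⟩
      Q (m -ℤ + suc n)             ∎

  2# : Carrier
  2# = 1# + 1#

  :2 : ∀ {m} → Polynomial m
  :2 = con 1 :+ con 1

  -- The semiring solver cannot subtract: an identity involving - t is proved
  -- as a semiring identity in which - t is a variable n, up to a multiple of
  -- t + n ≈ 0#.
  drop-null-summand : ∀ {x y z u} → z ≈ 0# → x ≈ y + z * u → x ≈ y
  drop-null-summand {y = y} {u = u} z≈0 x≈y+zu =
    trans x≈y+zu (trans (+-congˡ (trans (*-congʳ z≈0) (zeroˡ u))) (+-identityʳ y))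

  module _ (f g : Carrier) where

    CD : Carrier → Carrier → M2
    CD x y = (Cm f g ∙s x) +M (Dm f g ∙s y)

    CD-cong : ∀ {x x′ y y′} → x ≈ x′ → y ≈ y′ → CD x y ≈M CD x′ y′
    CD-cong p q = +-cong (*-congˡ p) (*-congˡ q) , +-cong (*-congˡ p) (*-congˡ q) ,
                  +-cong (*-congˡ p) (*-congˡ q) , +-cong (*-congˡ p) (*-congˡ q)

    CD·B : ∀ x y → (CD x y ·M Bm f g) ≈M CD (f * x + y) (g * x)
    CD·B x y =
      sym (drop-null-summand (-‿inverseʳ f) (e₁₁ f (- f) g x y)) ,
      drop-null-summand (-‿inverseʳ f) (e₁₂ f (- f) g x y) ,
      e₂₁ f g x y ,
      e₂₂ f g x y
      where
      e₁₁ : ∀ f n g x y → 2# * g * (f * x + y) + n * (g * x)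
                          ≈ ((2# * g * x + n * y) * 0# + (f * g * x + 2# * g * y) * 1#) + (f + n) * (g * x)
      e₁₁ = solve 5 (λ f n g x y → :2 :* g :* (f :* x :+ y) :+ n :* (g :* x)
                          := ((:2 :* g :* x :+ n :* y) :* con 0 :+ (f :* g :* x :+ :2 :* g :* y) :* con 1) :+ (f :+ n) :* (g :* x)) refl
      e₁₂ : ∀ f n g x y → (2# * g * x + n * y) * g + (f * g * x + 2# * g * y) * f
                          ≈ (f * g * (f * x + y) + 2# * g * (g * x)) + (f + n) * (y * g)
      e₁₂ = solve 5 (λ f n g x y → (:2 :* g :* x :+ n :* y) :* g :+ (f :* g :* x :+ :2 :* g :* y) :* f
                          := (f :* g :* (f :* x :+ y) :+ :2 :* g :* (g :* x)) :+ (f :+ n) :* (y :* g)) refl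
      e₂₁ : ∀ f g x y → (f * x + 2# * y) * 0# + ((f * f + 2# * g) * x + f * y) * 1# ≈ f * (f * x + y) + 2# * (g * x)
      e₂₁ = solve 4 (λ f g x y → (f :* x :+ :2 :* y) :* con 0 :+ ((f :* f :+ :2 :* g) :* x :+ f :* y) :* con 1
                          := f :* (f :* x :+ y) :+ :2 :* (g :* x)) refl
      e₂₂ : ∀ f g x y → (f * x + 2# * y) * g + ((f * f + 2# * g) * x + f * y) * f ≈ (f * f + 2# * g) * (f * x + y) + f * (g * x)
      e₂₂ = solve 4 (λ f g x y → (f :* x :+ :2 :* y) :* g :+ ((f :* f :+ :2 :* g) :* x :+ f :* y) :* f
                          := (f :* f :+ :2 :* g) :* (f :* x :+ y) :+ f :* (g :* x)) refl

    Am≈CD : ∀ h k y → k ≈ f * h + y → Am f g h k ≈M CD h y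
    Am≈CD h k y k≈fh+y =
      drop-null-summand (-‿inverseʳ f)
        (trans (+-congˡ (trans (-‿distribˡ-* f k) (*-congˡ k≈fh+y))) (e₁₁ f (- f) g h y)) ,
      drop-null-summand (-‿inverseʳ f)
        (trans (+-cong (*-congʳ (*-congˡ k≈fh+y)) (trans (-‿distribˡ-* (f * h) g) (*-congʳ (-‿distribˡ-* f h))))
               (e₁₂ f (- f) g h y)) ,
      drop-null-summand (-‿inverseʳ f)
        (trans (+-cong (*-congˡ k≈fh+y) (-‿distribˡ-* f h)) (e₂₁ f (- f) h y)) ,
      trans (+-congˡ (*-congˡ k≈fh+y)) (e₂₂ f g h y)
      where
      e₁₁ : ∀ f n g h y → (2# * g * h + f * f * h) + n * (f * h + y) ≈ (2# * g * h + n * y) + (f + n) * (f * h)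
      e₁₁ = solve 5 (λ f n g h y → (:2 :* g :* h :+ f :* f :* h) :+ n :* (f :* h :+ y)
                          := (:2 :* g :* h :+ n :* y) :+ (f :+ n) :* (f :* h)) refl
      e₁₂ : ∀ f n g h y → 2# * (f * h + y) * g + n * h * g ≈ (f * g * h + 2# * g * y) + (f + n) * (h * g)
      e₁₂ = solve 5 (λ f n g h y → :2 :* (f :* h :+ y) :* g :+ n :* h :* g
                          := (f :* g :* h :+ :2 :* g :* y) :+ (f :+ n) :* (h :* g)) refl
      e₂₁ : ∀ f n h y → 2# * (f * h + y) + n * h ≈ (f * h + 2# * y) + (f + n) * h
      e₂₁ = solve 4 (λ f n h y → :2 :* (f :* h :+ y) :+ n :* h := (f :* h :+ :2 :* y) :+ (f :+ n) :* h) refl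
      e₂₂ : ∀ f g h y → 2# * g * h + f * (f * h + y) ≈ (f * f + 2# * g) * h + f * y
      e₂₂ = solve 4 (λ f g h y → :2 :* g :* h :+ f :* (f :* h :+ y) := (f :* f :+ :2 :* g) :* h :+ f :* y) refl

    B·B⁻¹≈I : ∀ {ginv} → g * ginv ≈ 1# → (Bm f g ·M Binv f ginv) ≈M I2
    B·B⁻¹≈I {ginv} g·ginv≈1 =
      trans (+-cong (zeroˡ _) g·ginv≈1) (+-identityˡ 1#) ,
      trans (+-cong (zeroˡ 1#) (zeroʳ g)) (+-identityʳ 0#) ,
      trans (+-congʳ (*-identityˡ _)) (-‿inverseˡ (f * ginv)) ,
      trans (+-cong (*-identityˡ 1#) (zeroʳ f)) (+-identityʳ 1#)

lemma2p1 : ∀ {c ℓ : Level} (Rg : CommutativeRing c ℓ) →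
    let open CommutativeRing Rg
        open Mat2 Rg
    in (f g h k ginv : Carrier) →
       ¬ (f ≈ 0#) → (g * ginv ≈ 1#) →
       (R : ℤ → Carrier) →
       R (+ 0) ≈ h → R (+ 1) ≈ k →
       (∀ (n : ℤ) → R (n +ℤ + 1) ≈ f * R n + g * R (n -ℤ + 1)) →
       ∀ (n : ℤ) →
         (Am f g h k ·M Bpow f g ginv n)
           ≈M ((Cm f g ∙s R n) +M (Dm f g ∙s (g * R (n -ℤ + 1))))
lemma2p1 Rg f g h k ginv _ g·ginv≈1 R R₀≈h R₁≈k R-rec = A·Bⁿ≈Q
  where
  open CommutativeRing Rg
  open Mat2 Rg
  open MatrixIdentities Rg

  Q : ℤ → M2
  Q n = CD f g (R n) (g * R (n -ℤ + 1))

  Q-suc : ∀ n → Q (n +ℤ + 1) ≈M (Q n ·M Bm f g)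
  Q-suc n = ≈M-trans (CD-cong f g (R-rec n) (*-congˡ (reflexive (≡.cong R ([i+1]-1≡i n)))))
                     (≈M-sym (CD·B f g (R n) (g * R (n -ℤ + 1))))

  A≈Q₀ : Am f g h k ≈M Q (+ 0)
  A≈Q₀ = ≈M-trans (Am≈CD f g h k _ (trans (sym R₁≈k) (trans (R-rec (+ 0)) (+-congʳ (*-congˡ R₀≈h)))))
                  (CD-cong f g (sym R₀≈h) refl)

  open Orbit (Bm f g) (Binv f ginv) (B·B⁻¹≈I f g g·ginv≈1) Q Q-suc

  A·Bⁿ≈Q : ∀ n → (Am f g h k ·M Bpow f g ginv n) ≈M Q n
  A·Bⁿ≈Q (+ n)    = ≈M-trans (·M-congʳ A≈Q₀) (Q·B^ (+ 0) n)
  A·Bⁿ≈Q -[1+ n ] = ≈M-trans (·M-congʳ A≈Q₀) (Q·B⁻¹^ (+ 0) (suc n))
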